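{- Let $L\subset\mathbb{R}^n$ be a full-rank lattice with basis matrix $\mathrm{B}\in\mathbb{R}^{n\times n}$, let $t\in\mathbb{R}^n$ be a target vector, let $\textsf{BDD}_{\alpha}$ be an $\alpha$-BDD oracle with $\alpha<0.5$, and let $p$ be an integer with $p\alpha>1$. Consider the algorithm $\textsf{Enum}$ that, for every $s\in\mathbb{Z}_p^n=\{0,1,\dots,p-1\}^n$, computes and outputs the vector \[ -p\cdot\textsf{BDD}_{\alpha}\!\left(L,\tfrac{\mathrm{B}s-t}{p}\right)+\mathrm{B}s . \] Then the list output by $\textsf{Enum}$ contains all lattice points of $L$ within distance $p\alpha\lambda_1(L)$ of $t$ (possibly together with other lattice points); in particular $\textsf{Enum}$ makes $p^n$ queries to $\textsf{BDD}_\alpha$.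
   Context: A lattice $L$ with basis matrix $\mathrm{B}=[b_1\cdots b_n]$ (columns linearly independent) is $\{\mathrm{B}x:x\in\mathbb{Z}^n\}$. $\|\cdot\|$ is the Euclidean norm, $\mathrm{dist}(t,L)=\min_{x\in L}\|t-x\|$, and $\lambda_1(L)$ is the length of a shortest nonzero vector of $L$. For $\alpha<1/2$, an $\alpha$-BDD oracle $\textsf{BDD}_\alpha$ takes a (basis of a) lattice $\Lambda\subset\mathbb{R}^n$ and a target $t'\in\mathbb{R}^n$ with $\mathrm{dist}(\Lambda,t')\le\alpha\lambda_1(\Lambda)$ and returns a vector $v\in\Lambda$ with $\|v-t'\|\le\alpha\lambda_1(\Lambda)$. -}

module Defs where

open import Data.Nat using (ℕ; zero; suc)
open import Data.Integer using (ℤ; +_; -[1+_])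
open import Data.Fin using (Fin)
import Data.Fin
open import Data.Product using (Σ; _×_; ∃)
open import Relation.Nullary using (¬_)
open import Relation.Binary.PropositionalEquality using (_≡_)
open import Algebra.Structures using (IsCommutativeRing)
open import Relation.Binary.Structures using (IsTotalOrder)

-- The real numbers ℝ are the intended
-- instance; the statement below is quantified over every such field.
record EuclideanOrderedField : Set₁ where
  infixl 6 _+_
  infixl 7 _*_
  infix  4 _≤_
  field
    Carrier : Set
    0# 1#   : Carrier
    _+_ _*_ : Carrier → Carrier → Carrier
    -_      : Carrier → Carrier
    _⁻¹     : Carrier → Carrier
    _≤_     : Carrier → Carrier → Set
    isCommutativeRing : IsCommutativeRing _≡_ _+_ _*_ -_ 0# 1#
    0≢1     : ¬ (0# ≡ 1#)
    inverse : ∀ x → ¬ (x ≡ 0#) → x * (x ⁻¹) ≡ 1#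
    isTotalOrder : IsTotalOrder _≡_ _≤_
    +-mono  : ∀ x y z → x ≤ y → x + z ≤ y + z
    *-nonneg : ∀ x y → 0# ≤ x → 0# ≤ y → 0# ≤ x * y
    sqrt    : Carrier → Carrier
    sqrt-nonneg : ∀ x → 0# ≤ x → 0# ≤ sqrt x
    sqrt-sq : ∀ x → 0# ≤ x → sqrt x * sqrt x ≡ x

module Lattices (R : EuclideanOrderedField) where
  open EuclideanOrderedField R

  _-_ : Carrier → Carrier → Carrier
  x - y = x + (- y)

  infix 4 _<_
  infixl 6 _⊕_ _⊖_ _-_
  infixr 7 _·_
  _<_ : Carrier → Carrier → Set
  x < y = (x ≤ y) × ¬ (x ≡ y)

  fromℕ : ℕ → Carrier
  fromℕ zero    = 0#
  fromℕ (suc n) = 1# + fromℕ n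

  2# : Carrier
  2# = 1# + 1#

  fromℤ : ℤ → Carrier
  fromℤ (+ n)      = fromℕ n
  fromℤ -[1+ n ]   = - fromℕ (suc n)

  Σ[<_] : ∀ {n} → (Fin n → Carrier) → Carrier
  Σ[<_] {zero}  f = 0#
  Σ[<_] {suc n} f = f Data.Fin.zero + Σ[< (λ i → f (Data.Fin.suc i)) ]

  -- vectors in F^n and n×k matrices (entry B i j: row i, column j;
  -- the columns are the basis vectors b_1 … b_k)
  Vecᶠ : ℕ → Set
  Vecᶠ n = Fin n → Carrier

  Mat : ℕ → ℕ → Set
  Mat n k = Fin n → Fin k → Carrier

  _⊕_ : ∀ {n} → Vecᶠ n → Vecᶠ n → Vecᶠ n
  (u ⊕ v) i = u i + v i

  _⊖_ : ∀ {n} → Vecᶠ n → Vecᶠ n → Vecᶠ n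
  (u ⊖ v) i = u i - v i

  _·_ : ∀ {n} → Carrier → Vecᶠ n → Vecᶠ n
  (c · v) i = c * v i

  _✶_ : ∀ {n k} → Mat n k → Vecᶠ k → Vecᶠ n
  (B ✶ x) i = Σ[< (λ j → B i j * x j) ]

  _✶ℤ_ : ∀ {n k} → Mat n k → (Fin k → ℤ) → Vecᶠ n
  B ✶ℤ x = B ✶ (λ j → fromℤ (x j))

  LinIndep : ∀ {n k} → Mat n k → Set
  LinIndep B = ∀ c → (∀ i → (B ✶ c) i ≡ 0#) → ∀ j → c j ≡ 0#

  InLattice : ∀ {n k} → Mat n k → Vecᶠ n → Set
  InLattice B v = ∃ λ (x : Fin _ → ℤ) → ∀ i → v i ≡ (B ✶ℤ x) i

  IsZero : ∀ {n} → Vecᶠ n → Set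
  IsZero v = ∀ i → v i ≡ 0#

  ‖_‖ : ∀ {n} → Vecᶠ n → Carrier
  ‖ v ‖ = sqrt Σ[< (λ i → v i * v i) ]

  IsLambda1 : ∀ {n k} → Mat n k → Carrier → Set
  IsLambda1 B ℓ =
    (∃ λ v → InLattice B v × ¬ IsZero v × ‖ v ‖ ≡ ℓ)
    × (∀ v → InLattice B v → ¬ IsZero v → ℓ ≤ ‖ v ‖)

  Oracle : ℕ → Set
  Oracle n = ∀ {k} → Mat n k → Vecᶠ n → Vecᶠ n

  IsBDDOracle : ∀ {n} → Carrier → Oracle n → Set
  IsBDDOracle {n} α BDD =
    ∀ {k} (C : Mat n k) → LinIndep C → ∀ ℓ → IsLambda1 C ℓ →
    ∀ (t' : Vecᶠ n) →
    (∃ λ w → InLattice C w × ‖ w ⊖ t' ‖ ≤ α * ℓ) →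
    InLattice C (BDD C t') × ‖ BDD C t' ⊖ t' ‖ ≤ α * ℓ

  finVec : ∀ {n p} → (Fin n → Fin p) → Vecᶠ n
  finVec s j = fromℕ (Data.Fin.toℕ (s j))

  enumOut : ∀ {n} → Oracle n → Mat n n → Vecᶠ n → (p : ℕ) →
            (Fin n → Fin p) → Vecᶠ n
  enumOut BDD B t p s =
    ((- fromℕ p) · BDD B ((fromℕ p ⁻¹) · ((B ✶ finVec s) ⊖ t))) ⊕ (B ✶ finVec s)

module Submission where

-- Let v = B x be a lattice point with ‖v − t‖ ≤ p α λ₁.  Dividing every
-- integer coordinate of x by p gives x = s + p k with s ∈ {0,…,p−1}ⁿ.  For
-- this s the oracle is queried at t' = (B s − t)/p, and the lattice point
-- w = −B k satisfies w − t' = (t − v)/p, so ‖w − t'‖ ≤ α λ₁.  Hence the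
-- oracle answers some o ∈ L with ‖o − t'‖ ≤ α λ₁.  Two lattice points that
-- close to one target differ by a lattice vector of length ≤ 2αλ₁ < λ₁, so
-- they coincide (unique decoding); thus o = w and −p·o + B s = B s + p B k = v.

open import Defs
open import Data.Nat using (ℕ; zero; suc; NonZero)
import Data.Nat as ℕ
import Data.Nat.Properties as ℕP
open import Data.Integer using (ℤ; -[1+_])
import Data.Integer as ℤ
import Data.Integer.Properties as ℤP
import Data.Integer.DivMod as ℤDM
open import Data.Fin using (Fin)
import Data.Fin as F
import Data.Fin.Properties as FP
open import Data.Product using (_×_; ∃; _,_; proj₁; proj₂)
open import Data.Sum using (inj₁; inj₂)
open import Data.Empty using (⊥-elim)
open import Data.Maybe using (Maybe; just; nothing)
open import Relation.Nullary using (¬_; yes; no)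
open import Relation.Binary.PropositionalEquality
open import Relation.Binary.Bundles using (Poset)
import Relation.Binary.Reasoning.PartialOrder as PartialOrderReasoning
open import Relation.Binary.Structures using (IsTotalOrder)
open import Algebra.Bundles using (CommutativeRing)
import Algebra.Properties.AbelianGroup as AbelianGroupProperties
import Algebra.Properties.CommutativeSemigroup as CommutativeSemigroupProperties
import Algebra.Properties.Ring as RingProperties
import Algebra.Properties.Group as GroupProperties
import Algebra.Solver.Ring.AlmostCommutativeRing as ACR
import Algebra.Solver.Ring

module RingFacts (R : EuclideanOrderedField) where
  open EuclideanOrderedField R
  open Lattices R

  commutativeRing : CommutativeRing _ _
  commutativeRing = record { isCommutativeRing = isCommutativeRing }

  module CR = CommutativeRing commutativeRing
  open AbelianGroupProperties CR.+-abelianGroup public using (⁻¹-∙-comm)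
  open CommutativeSemigroupProperties CR.+-commutativeSemigroup public using (interchange)

  neg-zero : - 0# ≡ 0#
  neg-zero = RingProperties.-0#≈0# CR.ring

  fromℕ-+ : ∀ m n → fromℕ (m ℕ.+ n) ≡ fromℕ m + fromℕ n
  fromℕ-+ zero    n = sym (CR.+-identityˡ _)
  fromℕ-+ (suc m) n = trans (cong (1# +_) (fromℕ-+ m n)) (sym (CR.+-assoc _ _ _))

  fromℤ-⊖ : ∀ m n → fromℤ (m ℤ.⊖ n) ≡ fromℕ m - fromℕ n
  fromℤ-⊖ zero    zero    = sym (CR.-‿inverseʳ 0#)
  fromℤ-⊖ zero    (suc n) = sym (CR.+-identityˡ _)
  fromℤ-⊖ (suc m) zero    = sym (trans (cong (fromℕ (suc m) +_) neg-zero) (CR.+-identityʳ _))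
  fromℤ-⊖ (suc m) (suc n) = begin
    fromℤ (suc m ℤ.⊖ suc n)                 ≡⟨ cong fromℤ (ℤP.[1+m]⊖[1+n]≡m⊖n m n) ⟩
    fromℤ (m ℤ.⊖ n)                         ≡⟨ fromℤ-⊖ m n ⟩
    fromℕ m - fromℕ n                       ≡⟨ CR.+-identityˡ _ ⟨
    0# + (fromℕ m - fromℕ n)                ≡⟨ cong (_+ (fromℕ m - fromℕ n)) (CR.-‿inverseʳ 1#) ⟨
    (1# - 1#) + (fromℕ m - fromℕ n)         ≡⟨ interchange 1# (- 1#) (fromℕ m) (- fromℕ n) ⟩
    (1# + fromℕ m) + (- 1# - fromℕ n)       ≡⟨ cong ((1# + fromℕ m) +_) (⁻¹-∙-comm 1# (fromℕ n)) ⟩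
    fromℕ (suc m) - fromℕ (suc n)           ∎
    where open ≡-Reasoning

  fromℤ-+ : ∀ a b → fromℤ (a ℤ.+ b) ≡ fromℤ a + fromℤ b
  fromℤ-+ (ℤ.+ m)  (ℤ.+ n)  = fromℕ-+ m n
  fromℤ-+ (ℤ.+ m)  -[1+ n ] = fromℤ-⊖ m (suc n)
  fromℤ-+ -[1+ m ] (ℤ.+ n)  = trans (fromℤ-⊖ n (suc m)) (CR.+-comm _ _)
  fromℤ-+ -[1+ m ] -[1+ n ] = trans (cong -_ sizes) (sym (⁻¹-∙-comm _ _))
    where
    sizes : fromℕ (suc (suc (m ℕ.+ n))) ≡ fromℕ (suc m) + fromℕ (suc n)
    sizes = trans (cong (λ k → fromℕ (suc k)) (sym (ℕP.+-suc m n))) (fromℕ-+ (suc m) (suc n))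

  fromℤ-neg : ∀ a → fromℤ (ℤ.- a) ≡ - fromℤ a
  fromℤ-neg (ℤ.+ zero)    = sym neg-zero
  fromℤ-neg (ℤ.+ (suc n)) = refl
  fromℤ-neg -[1+ n ]      = sym (RingProperties.-‿involutive CR.ring _)

  fromℤ-*ℕ : ∀ a q → fromℤ (a ℤ.* ℤ.+ q) ≡ fromℤ a * fromℕ q
  fromℤ-*ℕ a zero    = trans (cong fromℤ (ℤP.*-zeroʳ a)) (sym (CR.zeroʳ _))
  fromℤ-*ℕ a (suc q) = begin
    fromℤ (a ℤ.* ℤ.+ suc q)                    ≡⟨ cong fromℤ (ℤP.*-distribˡ-+ a (ℤ.+ 1) (ℤ.+ q)) ⟩
    fromℤ (a ℤ.* ℤ.+ 1 ℤ.+ a ℤ.* ℤ.+ q)        ≡⟨ fromℤ-+ (a ℤ.* ℤ.+ 1) (a ℤ.* ℤ.+ q) ⟩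
    fromℤ (a ℤ.* ℤ.+ 1) + fromℤ (a ℤ.* ℤ.+ q)  ≡⟨ cong₂ _+_ (cong fromℤ (ℤP.*-identityʳ a)) (fromℤ-*ℕ a q) ⟩
    fromℤ a + fromℤ a * fromℕ q                ≡⟨ cong (_+ fromℤ a * fromℕ q) (CR.*-identityʳ _) ⟨
    fromℤ a * 1# + fromℤ a * fromℕ q           ≡⟨ CR.distribˡ _ _ _ ⟨
    fromℤ a * fromℕ (suc q)                    ∎
    where open ≡-Reasoning

  fromℤ-* : ∀ a b → fromℤ (a ℤ.* b) ≡ fromℤ a * fromℤ b
  fromℤ-* a (ℤ.+ q)  = fromℤ-*ℕ a q
  fromℤ-* a -[1+ n ] = begin
    fromℤ (a ℤ.* -[1+ n ])           ≡⟨ cong fromℤ (ℤP.neg-distribʳ-* a (ℤ.+ suc n)) ⟨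
    fromℤ (ℤ.- (a ℤ.* ℤ.+ suc n))    ≡⟨ fromℤ-neg (a ℤ.* ℤ.+ suc n) ⟩
    - fromℤ (a ℤ.* ℤ.+ suc n)        ≡⟨ cong -_ (fromℤ-*ℕ a (suc n)) ⟩
    - (fromℤ a * fromℕ (suc n))      ≡⟨ RingProperties.-‿distribʳ-* CR.ring _ _ ⟩
    fromℤ a * - fromℕ (suc n)        ∎
    where open ≡-Reasoning

  almostCommutativeRing : ACR.AlmostCommutativeRing _ _
  almostCommutativeRing = ACR.fromCommutativeRing commutativeRing

  fromℤ-homomorphism : ℤ.+-*-rawRing ACR.-Raw-AlmostCommutative⟶ almostCommutativeRing
  fromℤ-homomorphism = record
    { ⟦_⟧ = fromℤ ; +-homo = fromℤ-+ ; *-homo = fromℤ-* ; -‿homo = fromℤ-neg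
    ; 0-homo = refl ; 1-homo = CR.+-identityʳ 1# }

  coefficient-test : ∀ a b → Maybe (fromℤ a ≡ fromℤ b)
  coefficient-test a b with a ℤ.≟ b
  ... | yes a≡b = just (cong fromℤ a≡b)
  ... | no  _   = nothing

  open Algebra.Solver.Ring ℤ.+-*-rawRing almostCommutativeRing fromℤ-homomorphism coefficient-test
    public using (solve; _:+_; _:*_; :-_; _:-_; _:=_)

module OrderFacts (R : EuclideanOrderedField) where
  open EuclideanOrderedField R
  open Lattices R
  open RingFacts R
  open IsTotalOrder isTotalOrder public
    using (total; antisym) renaming (refl to ≤-refl; trans to ≤-trans; reflexive to ≤-reflexive)
  open GroupProperties CR.+-group using (x∙y⁻¹≈ε⇒x≈y)

  ≤-poset : Poset _ _ _
  ≤-poset = record { isPartialOrder = IsTotalOrder.isPartialOrder isTotalOrder }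

  module ≤-Reasoning = PartialOrderReasoning ≤-poset

  +-monoʳ-≤ : ∀ z {x y} → x ≤ y → z + x ≤ z + y
  +-monoʳ-≤ z {x} {y} x≤y = subst₂ _≤_ (CR.+-comm x z) (CR.+-comm y z) (+-mono x y z x≤y)

  +-mono-≤ : ∀ {a b c d} → a ≤ b → c ≤ d → a + c ≤ b + d
  +-mono-≤ {a} {b} a≤b c≤d = ≤-trans (+-mono a b _ a≤b) (+-monoʳ-≤ b c≤d)

  x≤y⇒0≤y-x : ∀ {x y} → x ≤ y → 0# ≤ y - x
  x≤y⇒0≤y-x {x} {y} x≤y = subst (_≤ y - x) (CR.-‿inverseʳ x) (+-mono x y (- x) x≤y)

  0≤y-x⇒x≤y : ∀ {x y} → 0# ≤ y - x → x ≤ y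
  0≤y-x⇒x≤y {x} {y} 0≤y-x = subst₂ _≤_ (CR.+-identityˡ x) (x-y+y y x) (+-mono 0# (y - x) x 0≤y-x)
    where
    x-y+y : ∀ u v → (u - v) + v ≡ u
    x-y+y = solve 2 (λ u v → (u :- v) :+ v := u) refl

  x≤y⇒x-y≤0 : ∀ {x y} → x ≤ y → x - y ≤ 0#
  x≤y⇒x-y≤0 {x} {y} x≤y = subst (x - y ≤_) (CR.-‿inverseʳ y) (+-mono x y (- y) x≤y)

  x≤0⇒0≤-x : ∀ {x} → x ≤ 0# → 0# ≤ - x
  x≤0⇒0≤-x {x} x≤0 = subst₂ _≤_ (CR.-‿inverseʳ x) (CR.+-identityˡ (- x)) (+-mono x 0# (- x) x≤0)

  x-y≡0⇒x≡y : ∀ {x y} → x - y ≡ 0# → x ≡ y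
  x-y≡0⇒x≡y = x∙y⁻¹≈ε⇒x≈y _ _

  sq-nonneg : ∀ x → 0# ≤ x * x
  sq-nonneg x with total 0# x
  ... | inj₁ 0≤x = *-nonneg x x 0≤x 0≤x
  ... | inj₂ x≤0 = subst (0# ≤_) (neg-square x) (*-nonneg (- x) (- x) (x≤0⇒0≤-x x≤0) (x≤0⇒0≤-x x≤0))
    where
    neg-square : ∀ y → - y * - y ≡ y * y
    neg-square = solve 1 (λ y → :- y :* :- y := y :* y) refl

  0≤1 : 0# ≤ 1#
  0≤1 = subst (0# ≤_) (CR.*-identityˡ 1#) (sq-nonneg 1#)

  0<1 : 0# < 1#
  0<1 = 0≤1 , 0≢1

  *-monoˡ-≤ : ∀ {c x y} → 0# ≤ c → x ≤ y → c * x ≤ c * y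
  *-monoˡ-≤ {c} {x} {y} 0≤c x≤y =
    0≤y-x⇒x≤y (subst (0# ≤_) (distrib c y x) (*-nonneg c (y - x) 0≤c (x≤y⇒0≤y-x x≤y)))
    where
    distrib : ∀ c y x → c * (y - x) ≡ c * y - c * x
    distrib = solve 3 (λ c y x → c :* (y :- x) := c :* y :- c :* x) refl

  sq-mono : ∀ {a b} → 0# ≤ a → a ≤ b → a * a ≤ b * b
  sq-mono {a} {b} 0≤a a≤b =
    ≤-trans (*-monoˡ-≤ 0≤a a≤b) (subst₂ _≤_ (CR.*-comm b a) refl (*-monoˡ-≤ (≤-trans 0≤a a≤b) a≤b))

  no-zero-divisors : ∀ {x y} → x * y ≡ 0# → ¬ x ≡ 0# → y ≡ 0#
  no-zero-divisors {x} {y} xy≡0 x≢0 = begin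
    y                  ≡⟨ CR.*-identityˡ y ⟨
    1# * y             ≡⟨ cong (_* y) (inverse x x≢0) ⟨
    x * x ⁻¹ * y       ≡⟨ regroup x (x ⁻¹) y ⟩
    x ⁻¹ * (x * y)     ≡⟨ cong (x ⁻¹ *_) xy≡0 ⟩
    x ⁻¹ * 0#          ≡⟨ CR.zeroʳ _ ⟩
    0#                 ∎
    where
    open ≡-Reasoning
    regroup : ∀ x z y → x * z * y ≡ z * (x * y)
    regroup = solve 3 (λ x z y → x :* z :* y := z :* (x :* y)) refl

  *-nonzero : ∀ {x y} → ¬ x ≡ 0# → ¬ y ≡ 0# → ¬ x * y ≡ 0#
  *-nonzero x≢0 y≢0 xy≡0 = y≢0 (no-zero-divisors xy≡0 x≢0)

  *-pos : ∀ {a b} → 0# < a → 0# < b → 0# < a * b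
  *-pos {a} {b} (0≤a , 0≢a) (0≤b , 0≢b) =
    *-nonneg a b 0≤a 0≤b , λ 0≡ab → *-nonzero (λ a≡0 → 0≢a (sym a≡0)) (λ b≡0 → 0≢b (sym b≡0)) (sym 0≡ab)

  nonneg-sum-zeroˡ : ∀ {a b} → 0# ≤ a → 0# ≤ b → a + b ≡ 0# → a ≡ 0#
  nonneg-sum-zeroˡ {a} {b} 0≤a 0≤b a+b≡0 =
    antisym (subst₂ _≤_ (CR.+-identityʳ a) a+b≡0 (+-monoʳ-≤ a 0≤b)) 0≤a

  nonneg-sum-zeroʳ : ∀ {a b} → 0# ≤ a → 0# ≤ b → a + b ≡ 0# → b ≡ 0#
  nonneg-sum-zeroʳ {a} {b} 0≤a 0≤b a+b≡0 = nonneg-sum-zeroˡ 0≤b 0≤a (trans (CR.+-comm b a) a+b≡0)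

  +-pos : ∀ {a b} → 0# < a → 0# ≤ b → 0# < a + b
  +-pos (0≤a , 0≢a) 0≤b =
    subst (_≤ _) (CR.+-identityʳ 0#) (+-mono-≤ 0≤a 0≤b) ,
    λ 0≡a+b → 0≢a (sym (nonneg-sum-zeroˡ 0≤a 0≤b (sym 0≡a+b)))

  -- without decidable equality, x * x ≡ 0# only refutes x ≢ 0#
  square-zero : ∀ {x} → x * x ≡ 0# → ¬ ¬ x ≡ 0#
  square-zero xx≡0 x≢0 = x≢0 (no-zero-divisors xx≡0 x≢0)

  sq-reflect : ∀ {a b} → 0# ≤ a → 0# < b → a * a ≤ b * b → a ≤ b
  sq-reflect {a} {b} 0≤a (0≤b , 0≢b) aa≤bb with total a b
  ... | inj₁ a≤b = a≤b
  ... | inj₂ b≤a = ≤-reflexive (x-y≡0⇒x≡y (no-zero-divisors product-zero a+b≢0))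
    where
    difference-of-squares : ∀ a b → (a + b) * (a - b) ≡ a * a - b * b
    difference-of-squares = solve 2 (λ a b → (a :+ b) :* (a :- b) := a :* a :- b :* b) refl
    product-zero : (a + b) * (a - b) ≡ 0#
    product-zero = begin
      (a + b) * (a - b)  ≡⟨ difference-of-squares a b ⟩
      a * a - b * b      ≡⟨ cong (_- b * b) (antisym aa≤bb (sq-mono 0≤b b≤a)) ⟩
      b * b - b * b      ≡⟨ CR.-‿inverseʳ (b * b) ⟩
      0#                 ∎
      where open ≡-Reasoning
    a+b≢0 : ¬ a + b ≡ 0#
    a+b≢0 a+b≡0 = 0≢b (sym (nonneg-sum-zeroʳ 0≤a 0≤b a+b≡0))

  not-below-fraction : ∀ {β x} → β < 1# → 0# < x → ¬ x ≤ β * x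
  not-below-fraction {β} {x} (β≤1 , β≢1) (0≤x , 0≢x) x≤βx =
    *-nonzero 1-β≢0 (λ x≡0 → 0≢x (sym x≡0)) (antisym gap≤0 (*-nonneg _ x (x≤y⇒0≤y-x β≤1) 0≤x))
    where
    expand : ∀ o β x → (o - β) * x ≡ o * x - β * x
    expand = solve 3 (λ o β x → (o :- β) :* x := o :* x :- β :* x) refl
    gap : (1# - β) * x ≡ x - β * x
    gap = trans (expand 1# β x) (cong (_- β * x) (CR.*-identityˡ x))
    gap≤0 : (1# - β) * x ≤ 0#
    gap≤0 = subst (_≤ 0#) (sym gap) (x≤y⇒x-y≤0 x≤βx)
    1-β≢0 : ¬ 1# - β ≡ 0#
    1-β≢0 1-β≡0 = β≢1 (sym (x-y≡0⇒x≡y 1-β≡0))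

  double-below-one : ∀ {α} → α < 2# ⁻¹ → α + α < 1#
  double-below-one {α} (α≤½ , α≢½) = subst (α + α ≤_) ½+½≡1 (+-mono-≤ α≤½ α≤½) , 2α≢1
    where
    ½ : Carrier
    ½ = 2# ⁻¹
    2≢0 : ¬ 2# ≡ 0#
    2≢0 2≡0 = proj₂ (+-pos 0<1 0≤1) (sym 2≡0)
    halves : ∀ h a → (h + h) * a ≡ h * (a + a)
    halves = solve 2 (λ h a → (h :+ h) :* a := h :* (a :+ a)) refl
    ½+½≡1 : ½ + ½ ≡ 1#
    ½+½≡1 = begin
      ½ + ½            ≡⟨ CR.*-identityʳ (½ + ½) ⟨
      (½ + ½) * 1#     ≡⟨ halves ½ 1# ⟩
      ½ * 2#           ≡⟨ CR.*-comm ½ 2# ⟩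
      2# * ½           ≡⟨ inverse 2# 2≢0 ⟩
      1#               ∎
      where open ≡-Reasoning
    2α≢1 : ¬ α + α ≡ 1#
    2α≢1 2α≡1 = α≢½ (begin
      α                ≡⟨ CR.*-identityˡ α ⟨
      1# * α           ≡⟨ cong (_* α) ½+½≡1 ⟨
      (½ + ½) * α      ≡⟨ halves ½ α ⟩
      ½ * (α + α)      ≡⟨ cong (½ *_) 2α≡1 ⟩
      ½ * 1#           ≡⟨ CR.*-identityʳ ½ ⟩
      ½                ∎)
      where open ≡-Reasoning

  fromℕ-nonneg : ∀ n → 0# ≤ fromℕ n
  fromℕ-nonneg zero    = ≤-refl
  fromℕ-nonneg (suc n) = proj₁ (+-pos 0<1 (fromℕ-nonneg n))

  fromℕ-pos : ∀ p .{{_ : NonZero p}} → 0# < fromℕ p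
  fromℕ-pos (suc n) = +-pos 0<1 (fromℕ-nonneg n)

  fromℤ-zero : ∀ a → fromℤ a ≡ 0# → a ≡ ℤ.0ℤ
  fromℤ-zero (ℤ.+ zero)    _    = refl
  fromℤ-zero (ℤ.+ (suc n)) a≡0 = ⊥-elim (proj₂ (fromℕ-pos (suc n)) (sym a≡0))
  fromℤ-zero -[1+ n ]      a≡0 = ⊥-elim (proj₂ (fromℕ-pos (suc n)) (sym (begin
    fromℕ (suc n)          ≡⟨ RingProperties.-‿involutive CR.ring _ ⟨
    - (- fromℕ (suc n))    ≡⟨ cong -_ a≡0 ⟩
    - 0#                   ≡⟨ neg-zero ⟩
    0#                     ∎)))
    where open ≡-Reasoning

  inverse-pos : ∀ {x} → 0# < x → 0# < x ⁻¹
  inverse-pos {x} (0≤x , 0≢x) = 0≤x⁻¹ , λ 0≡x⁻¹ → 0≢1 (begin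
    0#             ≡⟨ CR.zeroʳ x ⟨
    x * 0#         ≡⟨ cong (x *_) 0≡x⁻¹ ⟩
    x * x ⁻¹       ≡⟨ xx⁻¹≡1 ⟩
    1#             ∎)
    where
    open ≡-Reasoning
    xx⁻¹≡1 : x * x ⁻¹ ≡ 1#
    xx⁻¹≡1 = inverse x (λ x≡0 → 0≢x (sym x≡0))
    0≤x⁻¹ : 0# ≤ x ⁻¹
    0≤x⁻¹ with total 0# (x ⁻¹)
    ... | inj₁ 0≤x⁻¹ = 0≤x⁻¹
    ... | inj₂ x⁻¹≤0 = ⊥-elim (0≢1 (antisym 0≤1 (subst₂ _≤_ xx⁻¹≡1 (CR.zeroʳ x) (*-monoˡ-≤ 0≤x x⁻¹≤0))))

  fromℕ-nonZero : ∀ p {a} → 1# < fromℕ p * a → NonZero p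
  fromℕ-nonZero zero    {a} (1≤0a , _) = ⊥-elim (0≢1 (antisym 0≤1 (subst (1# ≤_) (CR.zeroˡ a) 1≤0a)))
  fromℕ-nonZero (suc p) _              = ℕ.nonZero

module SumFacts (R : EuclideanOrderedField) where
  open EuclideanOrderedField R
  open Lattices R
  open RingFacts R
  open OrderFacts R

  Σ-cong : ∀ {n} {f g : Fin n → Carrier} → (∀ i → f i ≡ g i) → Σ[< f ] ≡ Σ[< g ]
  Σ-cong {zero}  f≗g = refl
  Σ-cong {suc n} f≗g = cong₂ _+_ (f≗g F.zero) (Σ-cong (λ i → f≗g (F.suc i)))

  Σ-+ : ∀ {n} (f g : Fin n → Carrier) → Σ[< (λ i → f i + g i) ] ≡ Σ[< f ] + Σ[< g ]
  Σ-+ {zero}  f g = sym (CR.+-identityʳ 0#)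
  Σ-+ {suc n} f g = trans (cong (f F.zero + g F.zero +_) (Σ-+ (λ i → f (F.suc i)) (λ i → g (F.suc i))))
                          (interchange _ _ _ _)

  Σ-* : ∀ {n} (c : Carrier) (f : Fin n → Carrier) → Σ[< (λ i → c * f i) ] ≡ c * Σ[< f ]
  Σ-* {zero}  c f = sym (CR.zeroʳ c)
  Σ-* {suc n} c f = trans (cong (c * f F.zero +_) (Σ-* c (λ i → f (F.suc i)))) (sym (CR.distribˡ _ _ _))

  Σ-neg : ∀ {n} (f : Fin n → Carrier) → Σ[< (λ i → - f i) ] ≡ - Σ[< f ]
  Σ-neg {zero}  f = sym neg-zero
  Σ-neg {suc n} f = trans (cong (- f F.zero +_) (Σ-neg (λ i → f (F.suc i)))) (⁻¹-∙-comm _ _)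

  Σ-mono : ∀ {n} {f g : Fin n → Carrier} → (∀ i → f i ≤ g i) → Σ[< f ] ≤ Σ[< g ]
  Σ-mono {zero}  f≤g = ≤-refl
  Σ-mono {suc n} f≤g = +-mono-≤ (f≤g F.zero) (Σ-mono (λ i → f≤g (F.suc i)))

  Σ-nonneg : ∀ {n} {f : Fin n → Carrier} → (∀ i → 0# ≤ f i) → 0# ≤ Σ[< f ]
  Σ-nonneg {n} {f} 0≤f = subst (_≤ Σ[< f ]) (Σ-zero-const n) (Σ-mono {n} 0≤f)
    where
    Σ-zero-const : ∀ n → Σ[< (λ (_ : Fin n) → 0#) ] ≡ 0#
    Σ-zero-const zero    = refl
    Σ-zero-const (suc n) = trans (CR.+-identityˡ _) (Σ-zero-const n)

  Σ-zero : ∀ {n} {f : Fin n → Carrier} → (∀ i → 0# ≤ f i) → Σ[< f ] ≡ 0# → ∀ i → f i ≡ 0#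
  Σ-zero {suc n} 0≤f Σ≡0 F.zero    = nonneg-sum-zeroˡ (0≤f F.zero) (Σ-nonneg (λ i → 0≤f (F.suc i))) Σ≡0
  Σ-zero {suc n} 0≤f Σ≡0 (F.suc i) =
    Σ-zero (λ i → 0≤f (F.suc i)) (nonneg-sum-zeroʳ (0≤f F.zero) (Σ-nonneg (λ i → 0≤f (F.suc i))) Σ≡0) i

  ✶-cong : ∀ {n k} (B : Mat n k) {x y : Vecᶠ k} → (∀ j → x j ≡ y j) → ∀ i → (B ✶ x) i ≡ (B ✶ y) i
  ✶-cong {k = k} B x≗y i = Σ-cong {k} (λ j → cong (B i j *_) (x≗y j))

  ✶-⊕ : ∀ {n k} (B : Mat n k) (x y : Vecᶠ k) → ∀ i → (B ✶ (x ⊕ y)) i ≡ (B ✶ x) i + (B ✶ y) i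
  ✶-⊕ {k = k} B x y i = trans (Σ-cong {k} (λ j → CR.distribˡ (B i j) (x j) (y j))) (Σ-+ {k} _ _)

  ✶-· : ∀ {n k} (B : Mat n k) (c : Carrier) (x : Vecᶠ k) → ∀ i → (B ✶ (c · x)) i ≡ c * (B ✶ x) i
  ✶-· {k = k} B c x i = trans (Σ-cong {k} (λ j → swap (B i j) c (x j))) (Σ-* {k} c _)
    where
    swap : ∀ b c x → b * (c * x) ≡ c * (b * x)
    swap = solve 3 (λ b c x → b :* (c :* x) := c :* (b :* x)) refl

  ✶-neg : ∀ {n k} (B : Mat n k) (x : Vecᶠ k) → ∀ i → (B ✶ (λ j → - x j)) i ≡ - (B ✶ x) i
  ✶-neg {k = k} B x i = trans (Σ-cong {k} (λ j → sym (RingProperties.-‿distribʳ-* CR.ring (B i j) (x j)))) (Σ-neg {k} _)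

  ✶ℤ-neg : ∀ {n k} (B : Mat n k) (x : Fin k → ℤ) → ∀ i → (B ✶ℤ (λ j → ℤ.- x j)) i ≡ - (B ✶ℤ x) i
  ✶ℤ-neg B x i = trans (✶-cong B (λ j → fromℤ-neg (x j)) i) (✶-neg B _ i)

  ✶ℤ-sub : ∀ {n k} (B : Mat n k) (x y : Fin k → ℤ) →
           ∀ i → (B ✶ℤ (λ j → x j ℤ.- y j)) i ≡ (B ✶ℤ x) i - (B ✶ℤ y) i
  ✶ℤ-sub B x y i = begin
    (B ✶ℤ (λ j → x j ℤ.- y j)) i                          ≡⟨ ✶-cong B (λ j → fromℤ-+ (x j) (ℤ.- y j)) i ⟩
    (B ✶ ((λ j → fromℤ (x j)) ⊕ (λ j → fromℤ (ℤ.- y j)))) i ≡⟨ ✶-⊕ B _ _ i ⟩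
    (B ✶ℤ x) i + (B ✶ℤ (λ j → ℤ.- y j)) i                 ≡⟨ cong ((B ✶ℤ x) i +_) (✶ℤ-neg B y i) ⟩
    (B ✶ℤ x) i - (B ✶ℤ y) i                               ∎
    where open ≡-Reasoning

¬¬-∀-Fin : ∀ {n} (P : Fin n → Set) → (∀ i → ¬ ¬ P i) → ¬ ¬ (∀ i → P i)
¬¬-∀-Fin {zero}  P ¬¬P ¬∀P = ¬∀P (λ ())
¬¬-∀-Fin {suc n} P ¬¬P ¬∀P = ¬¬P F.zero λ P0 →
  ¬¬-∀-Fin (λ i → P (F.suc i)) (λ i → ¬¬P (F.suc i)) λ Prest →
    ¬∀P λ { F.zero → P0 ; (F.suc i) → Prest i }

module NormFacts (R : EuclideanOrderedField) where
  open EuclideanOrderedField R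
  open Lattices R
  open RingFacts R
  open OrderFacts R
  open SumFacts R

  ‖_‖² : ∀ {n} → Vecᶠ n → Carrier
  ‖ v ‖² = Σ[< (λ i → v i * v i) ]

  ‖‖²-nonneg : ∀ {n} (v : Vecᶠ n) → 0# ≤ ‖ v ‖²
  ‖‖²-nonneg {n} v = Σ-nonneg {n} (λ i → sq-nonneg (v i))

  ‖‖-nonneg : ∀ {n} (v : Vecᶠ n) → 0# ≤ ‖ v ‖
  ‖‖-nonneg v = sqrt-nonneg _ (‖‖²-nonneg v)

  ‖‖-square : ∀ {n} (v : Vecᶠ n) → ‖ v ‖ * ‖ v ‖ ≡ ‖ v ‖²
  ‖‖-square v = sqrt-sq _ (‖‖²-nonneg v)

  ‖‖-cong : ∀ {n} {u v : Vecᶠ n} → (∀ i → u i ≡ v i) → ‖ u ‖ ≡ ‖ v ‖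
  ‖‖-cong {n} u≗v = cong sqrt (Σ-cong {n} (λ i → cong₂ _*_ (u≗v i) (u≗v i)))

  ‖⊖‖-sym : ∀ {n} (u v : Vecᶠ n) → ‖ u ⊖ v ‖ ≡ ‖ v ⊖ u ‖
  ‖⊖‖-sym {n} u v = cong sqrt (Σ-cong {n} (λ i → flip (u i) (v i)))
    where
    flip : ∀ a b → (a - b) * (a - b) ≡ (b - a) * (b - a)
    flip = solve 2 (λ a b → (a :- b) :* (a :- b) := (b :- a) :* (b :- a)) refl

  ‖‖-definite : ∀ {n} (v : Vecᶠ n) → ‖ v ‖ ≡ 0# → ¬ ¬ IsZero v
  ‖‖-definite {n} v ‖v‖≡0 = ¬¬-∀-Fin (λ i → v i ≡ 0#) (λ i → square-zero (Σ-zero {n} (λ i → sq-nonneg (v i)) ‖v‖²≡0 i))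
    where
    ‖v‖²≡0 : ‖ v ‖² ≡ 0#
    ‖v‖²≡0 = trans (sym (‖‖-square v)) (trans (cong (λ z → z * z) ‖v‖≡0) (CR.zeroʳ 0#))

  ‖‖-from-square : ∀ {n} {r} (v : Vecᶠ n) → 0# < r → ‖ v ‖² ≤ r * r → ‖ v ‖ ≤ r
  ‖‖-from-square v 0<r v²≤r² = sq-reflect (‖‖-nonneg v) 0<r (subst (_≤ _) (sym (‖‖-square v)) v²≤r²)

  ‖‖-square-≤ : ∀ {n} {r} (v : Vecᶠ n) → ‖ v ‖ ≤ r → ‖ v ‖² ≤ r * r
  ‖‖-square-≤ v ‖v‖≤r = subst (_≤ _) (‖‖-square v) (sq-mono (‖‖-nonneg v) ‖v‖≤r)

  ‖·‖-≤ : ∀ {n} {c r} (u : Vecᶠ n) → 0# < c → 0# < r → ‖ u ‖ ≤ r → ‖ c · u ‖ ≤ c * r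
  ‖·‖-≤ {n} {c} {r} u 0<c 0<r ‖u‖≤r = ‖‖-from-square (c · u) (*-pos 0<c 0<r) (begin
    ‖ c · u ‖²                            ≡⟨ Σ-cong {n} (λ i → regroup c (u i)) ⟩
    Σ[< (λ i → (c * c) * (u i * u i)) ]   ≡⟨ Σ-* {n} (c * c) _ ⟩
    (c * c) * ‖ u ‖²                      ≤⟨ *-monoˡ-≤ (sq-nonneg c) (‖‖-square-≤ u ‖u‖≤r) ⟩
    (c * c) * (r * r)                     ≡⟨ regroup′ c r ⟩
    (c * r) * (c * r)                     ∎)
    where
    open ≤-Reasoning
    regroup : ∀ c x → (c * x) * (c * x) ≡ (c * c) * (x * x)
    regroup = solve 2 (λ c x → (c :* x) :* (c :* x) := (c :* c) :* (x :* x)) refl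
    regroup′ : ∀ c r → (c * c) * (r * r) ≡ (c * r) * (c * r)
    regroup′ = solve 2 (λ c r → (c :* c) :* (r :* r) := (c :* r) :* (c :* r)) refl

  -- two points within r of a common target are within 2r of each other;
  -- squared: (x − y)² ≤ 2x² + 2y² coordinatewise, with x = a − t, y = b − t
  close-points : ∀ {n} {r} (a b t : Vecᶠ n) → 0# < r →
                 ‖ a ⊖ t ‖ ≤ r → ‖ b ⊖ t ‖ ≤ r → ‖ a ⊖ b ‖ ≤ r + r
  close-points {n} {r} a b t 0<r a-close b-close = ‖‖-from-square (a ⊖ b) (+-pos 0<r (proj₁ 0<r)) (begin
    ‖ a ⊖ b ‖²                                            ≤⟨ Σ-mono {n} coordinatewise ⟩
    Σ[< (λ i → (X i + X i) + (Y i + Y i)) ]               ≡⟨ Σ-+ {n} _ _ ⟩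
    Σ[< (λ i → X i + X i) ] + Σ[< (λ i → Y i + Y i) ]     ≡⟨ cong₂ _+_ (Σ-+ {n} X X) (Σ-+ {n} Y Y) ⟩
    (‖ a ⊖ t ‖² + ‖ a ⊖ t ‖²) + (‖ b ⊖ t ‖² + ‖ b ⊖ t ‖²)  ≤⟨ +-mono-≤ (+-mono-≤ a² a²) (+-mono-≤ b² b²) ⟩
    (r * r + r * r) + (r * r + r * r)                     ≡⟨ four-squares r ⟩
    (r + r) * (r + r)                                     ∎)
    where
    open ≤-Reasoning
    X Y : Fin n → Carrier
    X i = (a ⊖ t) i * (a ⊖ t) i
    Y i = (b ⊖ t) i * (b ⊖ t) i
    a² : ‖ a ⊖ t ‖² ≤ r * r
    a² = ‖‖-square-≤ (a ⊖ t) a-close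
    b² : ‖ b ⊖ t ‖² ≤ r * r
    b² = ‖‖-square-≤ (b ⊖ t) b-close
    parallelogram : ∀ x y → ((x * x + x * x) + (y * y + y * y)) - (x - y) * (x - y) ≡ (x + y) * (x + y)
    parallelogram = solve 2 (λ x y → ((x :* x :+ x :* x) :+ (y :* y :+ y :* y)) :- (x :- y) :* (x :- y)
                                      := (x :+ y) :* (x :+ y)) refl
    through-t : ∀ a b t → a - b ≡ (a - t) - (b - t)
    through-t = solve 3 (λ a b t → a :- b := (a :- t) :- (b :- t)) refl
    coordinatewise : ∀ i → (a ⊖ b) i * (a ⊖ b) i ≤ (X i + X i) + (Y i + Y i)
    coordinatewise i = subst (λ z → z * z ≤ (X i + X i) + (Y i + Y i)) (sym (through-t (a i) (b i) (t i)))
      (0≤y-x⇒x≤y (subst (0# ≤_) (sym (parallelogram x y)) (sq-nonneg (x + y))))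
      where
      x y : Carrier
      x = (a ⊖ t) i
      y = (b ⊖ t) i
    four-squares : ∀ r → (r * r + r * r) + (r * r + r * r) ≡ (r + r) * (r + r)
    four-squares = solve 1 (λ r → (r :* r :+ r :* r) :+ (r :* r :+ r :* r) := (r :+ r) :* (r :+ r)) refl

  -- If v = b + P q with P > 0 and ‖v − t‖ ≤ P r, then −q lies within r of the
  -- rescaled target (b − t)/P, because −q − (b − t)/P = (t − v)/P.
  rescaled-target : ∀ {n} {P r} (v b q w t : Vecᶠ n) → 0# < P → 0# < r →
                    (∀ i → v i ≡ b i + P * q i) → (∀ i → w i ≡ - q i) →
                    ‖ v ⊖ t ‖ ≤ P * r → ‖ w ⊖ P ⁻¹ · (b ⊖ t) ‖ ≤ r
  rescaled-target {n} {P} {r} v b q w t 0<P 0<r v≡b+Pq w≡-q v-close = begin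
    ‖ w ⊖ P ⁻¹ · (b ⊖ t) ‖     ≡⟨ ‖‖-cong offset ⟩
    ‖ P ⁻¹ · (t ⊖ v) ‖         ≤⟨ ‖·‖-≤ (t ⊖ v) (inverse-pos 0<P) (*-pos 0<P 0<r) t-close ⟩
    P ⁻¹ * (P * r)             ≡⟨ CR.*-assoc (P ⁻¹) P r ⟨
    P ⁻¹ * P * r               ≡⟨ cong (_* r) P⁻¹P≡1 ⟩
    1# * r                     ≡⟨ CR.*-identityˡ r ⟩
    r                          ∎
    where
    open ≤-Reasoning
    P⁻¹P≡1 : P ⁻¹ * P ≡ 1#
    P⁻¹P≡1 = trans (CR.*-comm (P ⁻¹) P) (inverse P (λ P≡0 → proj₂ 0<P (sym P≡0)))
    t-close : ‖ t ⊖ v ‖ ≤ P * r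
    t-close = subst (_≤ P * r) (‖⊖‖-sym v t) v-close
    identity : ∀ c P b q t → - (c * P * q) - c * (b - t) ≡ c * (t - (b + P * q))
    identity = solve 5 (λ c P b q t → :- (c :* P :* q) :- c :* (b :- t) := c :* (t :- (b :+ P :* q))) refl
    offset : ∀ i → (w ⊖ P ⁻¹ · (b ⊖ t)) i ≡ (P ⁻¹ · (t ⊖ v)) i
    offset i = trans (cong (λ z → z - P ⁻¹ * (b i - t i)) (trans (w≡-q i) (cong -_ q≡P⁻¹Pq)))
                     (trans (identity (P ⁻¹) P (b i) (q i) (t i)) (cong (λ z → P ⁻¹ * (t i - z)) (sym (v≡b+Pq i))))
      where
      q≡P⁻¹Pq : q i ≡ P ⁻¹ * P * q i
      q≡P⁻¹Pq = trans (sym (CR.*-identityˡ (q i))) (cong (_* q i) (sym P⁻¹P≡1))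

module LatticeFacts (R : EuclideanOrderedField) where
  open EuclideanOrderedField R
  open Lattices R
  open RingFacts R
  open OrderFacts R
  open SumFacts R
  open NormFacts R

  λ₁-pos : ∀ {n k} {B : Mat n k} {λ₁} → IsLambda1 B λ₁ → 0# < λ₁
  λ₁-pos ((v , _ , v≢0 , ‖v‖≡λ₁) , _) =
    subst (0# <_) ‖v‖≡λ₁ (‖‖-nonneg v , λ 0≡‖v‖ → ‖‖-definite v (sym 0≡‖v‖) v≢0)

  no-short-vector : ∀ {n k} {B : Mat n k} {λ₁ β u} → IsLambda1 B λ₁ →
                    InLattice B u → ¬ IsZero u → β < 1# → ¬ ‖ u ‖ ≤ β * λ₁
  no-short-vector hλ u∈L u≢0 β<1 short =
    not-below-fraction β<1 (λ₁-pos hλ) (≤-trans (proj₂ hλ _ u∈L u≢0) short)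

  -- Unique decoding: two lattice points within α λ₁ < λ₁/2 of one target
  -- coincide, since their difference is a lattice vector of length ≤ 2αλ₁.
  -- Comparing coefficient vectors (decidable over ℤ) turns this into equality.
  unique-decoding : ∀ {n k} {B : Mat n k} {λ₁ α} → LinIndep B → IsLambda1 B λ₁ →
                    0# < α → α < 2# ⁻¹ → ∀ {a b t : Vecᶠ n} → InLattice B a → InLattice B b →
                    ‖ a ⊖ t ‖ ≤ α * λ₁ → ‖ b ⊖ t ‖ ≤ α * λ₁ → ∀ i → a i ≡ b i
  unique-decoding {B = B} {λ₁} {α} indep hλ 0<α α<½ {a} {b} {t} (x , a≡Bx) (y , b≡By) a-close b-close
    with FP.all? (λ j → x j ℤ.≟ y j)
  ... | yes x≡y = λ i → trans (a≡Bx i) (trans (✶-cong B (λ j → cong fromℤ (x≡y j)) i) (sym (b≡By i)))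
  ... | no  x≢y = ⊥-elim (no-short-vector hλ (x-y , λ i → refl) d≢0 (double-below-one α<½) d-short)
    where
    open ≤-Reasoning
    x-y : _ → ℤ
    x-y j = x j ℤ.- y j
    d : Vecᶠ _
    d = B ✶ℤ x-y
    d≢0 : ¬ IsZero d
    d≢0 d≡0 = x≢y (λ j → ℤP.i-j≡0⇒i≡j _ _ (fromℤ-zero _ (indep _ d≡0 j)))
    d-short : ‖ d ‖ ≤ (α + α) * λ₁
    d-short = begin
      ‖ d ‖               ≡⟨ ‖‖-cong (λ i → trans (✶ℤ-sub B x y i) (sym (cong₂ _-_ (a≡Bx i) (b≡By i)))) ⟩
      ‖ a ⊖ b ‖           ≤⟨ close-points a b t (*-pos 0<α (λ₁-pos hλ)) a-close b-close ⟩
      α * λ₁ + α * λ₁     ≡⟨ CR.distribʳ λ₁ α α ⟨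
      (α + α) * λ₁        ∎

  residue : ∀ {k} (p : ℕ) .{{_ : NonZero p}} → (Fin k → ℤ) → Fin k → Fin p
  residue p x j = F.fromℕ< (ℤDM.n%ℕd<d (x j) p)

  quotient : ∀ {k} (p : ℕ) .{{_ : NonZero p}} → (Fin k → ℤ) → Fin k → ℤ
  quotient p x j = x j ℤDM./ℕ p

  euclidean-split : ∀ {n k} (B : Mat n k) (p : ℕ) .{{_ : NonZero p}} (x : Fin k → ℤ) →
    ∀ i → (B ✶ℤ x) i ≡ (B ✶ finVec (residue p x)) i + fromℕ p * (B ✶ℤ quotient p x) i
  euclidean-split B p x i = begin
    (B ✶ℤ x) i                                       ≡⟨ ✶-cong B coordinate i ⟩
    (B ✶ (finVec s ⊕ fromℕ p · K)) i                 ≡⟨ ✶-⊕ B (finVec s) (fromℕ p · K) i ⟩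
    (B ✶ finVec s) i + (B ✶ (fromℕ p · K)) i         ≡⟨ cong ((B ✶ finVec s) i +_) (✶-· B (fromℕ p) K i) ⟩
    (B ✶ finVec s) i + fromℕ p * (B ✶ K) i           ∎
    where
    open ≡-Reasoning
    s = residue p x
    K : Vecᶠ _
    K j = fromℤ (quotient p x j)
    coordinate : ∀ j → fromℤ (x j) ≡ (finVec s ⊕ fromℕ p · K) j
    coordinate j = begin
      fromℤ (x j)                                              ≡⟨ cong fromℤ (ℤDM.a≡a%ℕn+[a/ℕn]*n (x j) p) ⟩
      fromℤ (ℤ.+ (x j ℤDM.%ℕ p) ℤ.+ quotient p x j ℤ.* ℤ.+ p)  ≡⟨ fromℤ-+ (ℤ.+ (x j ℤDM.%ℕ p)) (quotient p x j ℤ.* ℤ.+ p) ⟩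
      fromℕ (x j ℤDM.%ℕ p) + fromℤ (quotient p x j ℤ.* ℤ.+ p)  ≡⟨ cong₂ _+_ residue-value (fromℤ-*ℕ (quotient p x j) p) ⟩
      finVec s j + K j * fromℕ p                               ≡⟨ cong (finVec s j +_) (CR.*-comm (K j) (fromℕ p)) ⟩
      finVec s j + fromℕ p * K j                               ∎
      where
      residue-value : fromℕ (x j ℤDM.%ℕ p) ≡ finVec s j
      residue-value = cong fromℕ (sym (FP.toℕ-fromℕ< (ℤDM.n%ℕd<d (x j) p)))

-- Theorem 8.  Write v = B x and s = x mod p, k = x div p, so v = B s + p B k.
-- The lattice point −B k is within α λ₁ of the query (B s − t)/p, hence the
-- oracle answers a lattice point within α λ₁ of it, which by unique decoding
-- is −B k itself; the output for s is therefore −p (−B k) + B s = v.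
-- (The hypothesis 1 < p α is used only to know that p ≠ 0.)
theorem8 : (R : EuclideanOrderedField) →
    let open EuclideanOrderedField R in
    let open Lattices R in
    (n : ℕ) (B : Mat n n) → LinIndep B →
    (λ₁ : Carrier) → IsLambda1 B λ₁ →
    (t : Vecᶠ n) →
    (α : Carrier) → 0# < α → α < (2# ⁻¹) →
    (BDD : Oracle n) → IsBDDOracle α BDD →
    (p : ℕ) → 1# < fromℕ p * α →
    ∀ (v : Vecᶠ n) → InLattice B v → ‖ v ⊖ t ‖ ≤ fromℕ p * α * λ₁ →
    ∃ λ (s : Fin n → Fin p) → ∀ i → enumOut BDD B t p s i ≡ v i
theorem8 R n B indep λ₁ hλ t α 0<α α<½ BDD isBDD p 1<pα v (x , v≡Bx) v-close = s , λ i → begin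
  enumOut BDD B t p s i                  ≡⟨ cong (λ z → - P * z + Bs i) (o≡w i) ⟩
  - P * w i + Bs i                       ≡⟨ cong (λ z → - P * z + Bs i) (✶ℤ-neg B k i) ⟩
  - P * - (B ✶ℤ k) i + Bs i              ≡⟨ signs P ((B ✶ℤ k) i) (Bs i) ⟩
  Bs i + P * (B ✶ℤ k) i                  ≡⟨ v-split i ⟨
  v i                                    ∎
  where
  open EuclideanOrderedField R
  open Lattices R
  open RingFacts R
  open OrderFacts R
  open SumFacts R
  open NormFacts R
  open LatticeFacts R
  open ≡-Reasoning
  instance
    p≢0 : NonZero p
    p≢0 = fromℕ-nonZero p 1<pα
  P : Carrier
  P = fromℕ p
  s : Fin n → Fin p
  s = residue p x
  k : Fin n → ℤ
  k = quotient p x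
  Bs : Vecᶠ n
  Bs = B ✶ finVec s
  v-split : ∀ i → v i ≡ Bs i + P * (B ✶ℤ k) i
  v-split i = trans (v≡Bx i) (euclidean-split B p x i)
  query : Vecᶠ n
  query = P ⁻¹ · (Bs ⊖ t)
  -k : Fin n → ℤ
  -k j = ℤ.- k j
  w : Vecᶠ n
  w = B ✶ℤ -k
  w-close : ‖ w ⊖ query ‖ ≤ α * λ₁
  w-close = rescaled-target v Bs (B ✶ℤ k) w t (fromℕ-pos p) (*-pos 0<α (λ₁-pos hλ)) v-split (✶ℤ-neg B k)
              (subst (‖ v ⊖ t ‖ ≤_) (CR.*-assoc P α λ₁) v-close)
  answer : InLattice B (BDD B query) × ‖ BDD B query ⊖ query ‖ ≤ α * λ₁
  answer = isBDD B indep λ₁ hλ query (w , (-k , λ i → refl) , w-close)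
  o≡w : ∀ i → BDD B query i ≡ w i
  o≡w = unique-decoding indep hλ 0<α α<½ (proj₁ answer) (-k , λ i → refl) (proj₂ answer) w-close
  signs : ∀ P q b → - P * - q + b ≡ b + P * q
  signs = solve 3 (λ P q b → :- P :* :- q :+ b := b :+ P :* q) refl
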